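{- In any Q-structure, for every fact $F$: $F=\mathbf1\otimes F$ and $F\subseteq F\otimes\mathbf1$.
   Context: A Q-structure is a tuple $\langle\mathcal P,\mathcal Z,\cdot,1\rangle$ with $\mathcal P$ a set, $\mathcal Z\subseteq\mathcal P$, $\cdot$ a binary operation on $\mathcal P$ (not assumed associative or commutative), and $1\in\mathcal P$. These satisfy, for all $x,y,z$: $x\cdot y\in\mathcal Z$ iff $y\cdot x\in\mathcal Z$; $(x\cdot y)\cdot z\in\mathcal Z$ iff $x\cdot(z\cdot y)\in\mathcal Z$; and $1\cdot x=x\cdot1=x$. For $A\subseteq\mathcal P$, $A^\perp=\{b: b\cdot a\in\mathcal Z\ \forall a\in A\}$. A fact is a subset $F$ with $F=(F^\perp)^\perp$. For $A,B\subseteq\mathcal P$, $A\cdot B=\{a\cdot b:a\in A,b\in B\}$. For facts $F,G$, $F\otimes G=((F\cdot G)^\perp)^\perp$, and $\mathbf1=\mathcal Z^\perp$. -}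

module Defs where

open import Level using (Level; suc; _⊔_)
open import Data.Product using (Σ; _×_; _,_; ∃)
open import Relation.Binary.PropositionalEquality using (_≡_)
open import Relation.Unary using (Pred; _⊆_)

record QStructure (ℓ : Level) : Set (suc ℓ) where
  field
    P    : Set ℓ
    Z    : Pred P ℓ
    _·_  : P → P → P
    one  : P
    Z-comm  : ∀ x y → (Z (x · y) → Z (y · x)) × (Z (y · x) → Z (x · y))
    Z-shift : ∀ x y z → (Z ((x · y) · z) → Z (x · (z · y)))
                      × (Z (x · (z · y)) → Z ((x · y) · z))
    one-left  : ∀ x → one · x ≡ x
    one-right : ∀ x → x · one ≡ x

module QS {ℓ : Level} (Q : QStructure ℓ) where
  open QStructure Q public

  _≐_ : Pred P ℓ → Pred P ℓ → Set ℓ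
  A ≐ B = (A ⊆ B) × (B ⊆ A)

  _⊥ : Pred P ℓ → Pred P ℓ
  (A ⊥) b = ∀ a → A a → Z (b · a)

  IsFact : Pred P ℓ → Set ℓ
  IsFact F = F ≐ ((F ⊥) ⊥)

  _·ˢ_ : Pred P ℓ → Pred P ℓ → Pred P ℓ
  (A ·ˢ B) c = Σ P λ a → Σ P λ b → A a × B b × (c ≡ a · b)

  _⊗_ : Pred P ℓ → Pred P ℓ → Pred P ℓ
  F ⊗ G = ((F ·ˢ G) ⊥) ⊥

  𝟏 : Pred P ℓ
  𝟏 = Z ⊥

{-# OPTIONS --safe #-}
module Submission where

-- 1 ∈ 𝟏, so F ⊆ 𝟏·F and F ⊆ F·𝟏, and closing under ⊥⊥ gives both inclusions
-- into the tensors.  Conversely, for u ∈ 𝟏 = Z^⊥, f ∈ F and y ∈ F^⊥ we have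
-- y·f ∈ Z, hence u·(y·f) ∈ Z, which the shift axiom turns into (u·f)·y ∈ Z;
-- so 𝟏·F ⊆ F^⊥⊥, and 𝟏 ⊗ F ⊆ F^⊥⊥⊥⊥ ⊆ F^⊥⊥ = F for a fact F.

open import Defs
open import Level using (Level)
open import Data.Product using (_×_; _,_; proj₁; proj₂)
open import Relation.Unary using (Pred; _⊆_)
open import Relation.Binary.PropositionalEquality using (refl; subst; sym)

module QStructureProperties {ℓ : Level} (Q : QStructure ℓ) where
  open QS Q

  ⊆-⊥⊥ : {A : Pred P ℓ} → A ⊆ (A ⊥) ⊥
  ⊆-⊥⊥ {A} {x} x∈A y y∈A⊥ = proj₁ (Z-comm y x) (y∈A⊥ x x∈A)

  ⊥-antitone : {A B : Pred P ℓ} → A ⊆ B → B ⊥ ⊆ A ⊥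
  ⊥-antitone A⊆B y∈B⊥ a a∈A = y∈B⊥ a (A⊆B a∈A)

  ⊥⊥-monotone : {A B : Pred P ℓ} → A ⊆ B → (A ⊥) ⊥ ⊆ (B ⊥) ⊥
  ⊥⊥-monotone A⊆B = ⊥-antitone (⊥-antitone A⊆B)

  one∈𝟏 : 𝟏 one
  one∈𝟏 z z∈Z = subst Z (sym (one-left z)) z∈Z

  ⊆-𝟏·ˢ : {A : Pred P ℓ} → A ⊆ 𝟏 ·ˢ A
  ⊆-𝟏·ˢ {x = x} x∈A = one , x , one∈𝟏 , x∈A , sym (one-left x)

  ⊆-·ˢ𝟏 : {A : Pred P ℓ} → A ⊆ A ·ˢ 𝟏
  ⊆-·ˢ𝟏 {x = x} x∈A = x , one , x∈A , one∈𝟏 , sym (one-right x)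

  𝟏·ˢ-⊆-⊥⊥ : {A : Pred P ℓ} → 𝟏 ·ˢ A ⊆ (A ⊥) ⊥
  𝟏·ˢ-⊆-⊥⊥ (u , a , u∈𝟏 , a∈A , refl) y y∈A⊥ =
    proj₂ (Z-shift u a y) (u∈𝟏 (y · a) (y∈A⊥ a a∈A))

  ⊆-𝟏⊗ : {A : Pred P ℓ} → A ⊆ 𝟏 ⊗ A
  ⊆-𝟏⊗ x∈A = ⊆-⊥⊥ (⊆-𝟏·ˢ x∈A)

  ⊆-⊗𝟏 : {A : Pred P ℓ} → A ⊆ A ⊗ 𝟏
  ⊆-⊗𝟏 x∈A = ⊆-⊥⊥ (⊆-·ˢ𝟏 x∈A)

  𝟏⊗-⊆ : {F : Pred P ℓ} → IsFact F → 𝟏 ⊗ F ⊆ F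
  𝟏⊗-⊆ {F} (_ , F⊥⊥⊆F) x∈𝟏⊗F = F⊥⊥⊆F (⊥⊥-monotone 𝟏·ˢF⊆F x∈𝟏⊗F)
    where
    𝟏·ˢF⊆F : 𝟏 ·ˢ F ⊆ F
    𝟏·ˢF⊆F x∈𝟏·ˢF = F⊥⊥⊆F (𝟏·ˢ-⊆-⊥⊥ x∈𝟏·ˢF)

lemma6 : ∀ {ℓ : Level} (Q : QStructure ℓ) → let open QS Q in
    ∀ (F : Pred P ℓ) → IsFact F → (F ≐ (𝟏 ⊗ F)) × (F ⊆ (F ⊗ 𝟏))
lemma6 Q F isFact = (⊆-𝟏⊗ , 𝟏⊗-⊆ isFact) , ⊆-⊗𝟏
  where open QStructureProperties Q
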